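{- Let $q>2$ and $n\ge 1$ be integers. There is no affine function $f:\mathbb{Z}_q^n\to\mathbb{Z}_q$ (i.e. $f(\mathbf{x})=\langle\mathbf{a},\mathbf{x}\rangle+b$ with $\mathbf{a}\in\mathbb{Z}_q^n$, $b\in\mathbb{Z}_q$) such that $|\mathcal{N}'_f(\mathbf{u})|=1$ for all $\mathbf{u}\in\mathbb{Z}_q^n$.
   Context: $\mathbb{Z}_q$ is the ring of integers modulo $q$. For $x\in\mathbb{Z}_q$, $\hat{x}\in\{0,\ldots,q-1\}$ is its least non-negative integer representative, and $\hat{\mathbf{x}}=(\hat{x}_1,\ldots,\hat{x}_n)$ for $\mathbf{x}\in\mathbb{Z}_q^n$. Let $\xi$ be a primitive $q$-th root of unity and $\omega$ a primitive $2q$-th root of unity. For $f:\mathbb{Z}_q^n\to\mathbb{Z}_q$, the $q$-nega-Hadamard transform is $$\mathcal{N}'_f(\mathbf{u})=\frac{1}{q^{n/2}}\sum_{\mathbf{x}\in\mathbb{Z}_q^n}\xi^{f(\mathbf{x})}\,\xi^{\langle\hat{\mathbf{x}},\hat{\mathbf{u}}\rangle}\,\omega^{\sum_i\hat{x}_i},\qquad \mathbf{u}\in\mathbb{Z}_q^n,$$ where $\langle\hat{\mathbf{x}},\hat{\mathbf{u}}\rangle=\sum_i\hat x_i\hat u_i$. -}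

module Defs where

open import Level using (Level; _⊔_)
open import Algebra.Bundles using (CommutativeRing)
open import Data.Nat as N using (ℕ; zero; suc; _%_; _<_; NonZero)
open import Data.Fin as Fin using (Fin; toℕ)
open import Data.Fin.Properties using ()
open import Data.Vec.Functional using (Vector; _∷_)
open import Data.List using (List; foldr; map)
open import Data.List.Base using (allFin)
open import Relation.Nullary using (¬_)
open import Data.Product using (∃)

module _ {c ℓ : Level} (R : CommutativeRing c ℓ) where
  open CommutativeRing R

  pow : Carrier → ℕ → Carrier
  pow x zero    = 1#
  pow x (suc k) = x * pow x k

  ℕ→R : ℕ → Carrier
  ℕ→R zero    = 0#
  ℕ→R (suc k) = 1# + ℕ→R k

  sumFin : (q : ℕ) → (Fin q → Carrier) → Carrier
  sumFin q g = foldr _+_ 0# (map g (allFin q))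

  sumVec : (q n : ℕ) → (Vector (Fin q) n → Carrier) → Carrier
  sumVec q zero    g = g (λ ())
  sumVec q (suc n) g = sumFin q (λ j → sumVec q n (λ x → g (j ∷ x)))

  -- A field of characteristic 0 with an involutive automorphism `conj`
  -- (playing the role of complex conjugation), containing a primitive
  -- 2q-th root of unity ω, a primitive q-th root of unity ξ (both with
  -- conj = inverse, as on the unit circle), and a real (conj-fixed)
  -- element t with t² · q = 1, i.e. t = ±1/√q.
  record Setting (q : ℕ) : Set (c ⊔ ℓ) where
    field
      field-inv  : ∀ x → ¬ (x ≈ 0#) → ∃ λ y → x * y ≈ 1#
      char0      : ∀ m → ¬ (ℕ→R (suc m) ≈ 0#)
      conj       : Carrier → Carrier
      conj-cong  : ∀ {x y} → x ≈ y → conj x ≈ conj y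
      conj-+     : ∀ x y → conj (x + y) ≈ conj x + conj y
      conj-*     : ∀ x y → conj (x * y) ≈ conj x * conj y
      conj-1     : conj 1# ≈ 1#
      conj-invol : ∀ x → conj (conj x) ≈ x
      ω          : Carrier
      ω-root     : pow ω (2 N.* q) ≈ 1#
      ω-prim     : ∀ k → 0 < k → k < 2 N.* q → ¬ (pow ω k ≈ 1#)
      ω-conj     : conj ω * ω ≈ 1#
      ξ          : Carrier
      ξ-root     : pow ξ q ≈ 1#
      ξ-prim     : ∀ k → 0 < k → k < q → ¬ (pow ξ k ≈ 1#)
      ξ-conj     : conj ξ * ξ ≈ 1#
      t          : Carrier
      t-conj     : conj t ≈ t
      t-sq       : t * t * ℕ→R q ≈ 1#

  module _ {q : ℕ} (S : Setting q) where
    open Setting S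

    affineRep : {n : ℕ} → {{_ : NonZero q}} →
                Vector (Fin q) n → Fin q → Vector (Fin q) n → ℕ
    affineRep {zero}  a b x = toℕ b % q
    affineRep {suc n} a b x =
      (toℕ (a Fin.zero) N.* toℕ (x Fin.zero) N.+ affineRep (λ i → a (Fin.suc i)) b (λ i → x (Fin.suc i))) % q

    dotℕ : {n : ℕ} → Vector (Fin q) n → Vector (Fin q) n → ℕ
    dotℕ {zero}  x u = 0
    dotℕ {suc n} x u = toℕ (x Fin.zero) N.* toℕ (u Fin.zero)
                       N.+ dotℕ (λ i → x (Fin.suc i)) (λ i → u (Fin.suc i))

    sumℕ : {n : ℕ} → Vector (Fin q) n → ℕ
    sumℕ {zero}  x = 0
    sumℕ {suc n} x = toℕ (x Fin.zero) N.+ sumℕ (λ i → x (Fin.suc i))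

    -- q-nega-Hadamard transform of f : Z_q^n → Z_q (f given by representatives f̂(x))
    negaHadamard : (n : ℕ) → (Vector (Fin q) n → ℕ) → Vector (Fin q) n → Carrier
    negaHadamard n f u =
      pow t n * sumVec q n (λ x → pow ξ (f x) * pow ξ (dotℕ x u) * pow ω (sumℕ x))

    Unimodular : Carrier → Set ℓ
    Unimodular z = z * conj z ≈ 1#

-- Split off the first coordinate: for affine f the transform factors as
-- N(u₀ ∷ u) = G(ζ) · t · N'(u), with G(z) = Σ_{j<q} z^j and ζ = ξ^(a₀+u₀) ω.
-- Letting u₀ vary, ζ runs through all ξ^c ω, and (ξ^c ω)^q = ω^q = -1 gives
-- G(ζ)(1 - ζ) = 2; so unimodularity forces |1 - ξ^c ω|² = 4 |t N'(u)|² for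
-- every c. But for w, x on the unit circle with x ≠ 1, |1 - w| = |1 - x w|
-- implies x w² = 1; taking x = ξ and x = ξ² yields ξ = 1.

module Submission where

open import Defs
open import Algebra.Bundles using (CommutativeRing)
open import Data.Nat using (ℕ; _<_; _≤_; NonZero)
open import Data.Fin using (Fin)
open import Data.Vec.Functional using (Vector)
open import Relation.Nullary using (¬_)

open import Data.Nat as ℕ using (zero; suc; s≤s; z≤n; _%_; _/_; _∸_)
open import Data.Nat.DivMod using (m≡m%n+[m/n]*n; m%n<n)
import Data.Nat.Properties as ℕ
open import Data.Fin as Fin using (toℕ; fromℕ<)
open import Data.Fin.Properties using (toℕ-fromℕ<; toℕ<n)
open import Data.Vec.Functional using (_∷_; tail)
open import Data.List using (foldr; tabulate)
open import Data.List.Properties using (map-tabulate)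
open import Data.Product using (∃; _,_)
open import Relation.Binary.PropositionalEquality as ≡ using (_≡_)

module _ {c ℓ} (R : CommutativeRing c ℓ) where
  open CommutativeRing R
  open import Relation.Binary.Reasoning.Setoid setoid
  open import Algebra.Properties.CommutativeSemiring.Exp commutativeSemiring
  open import Algebra.Properties.Semiring.Sum semiring
    using (sum; sum-syntax; sum-cong-≋; *-distribˡ-sum; *-distribʳ-sum)
  open import Algebra.Properties.Ring ring using ([y-z]x≈yx-zx)
  open import Algebra.Properties.Group +-group
    using (∙-cancelˡ; ∙-cancelʳ; //-rightDividesˡ; x∙y⁻¹≈ε⇒x≈y; x≈y⇒x∙y⁻¹≈ε)
  open import Algebra.Solver.Ring.NaturalCoefficients.Default commutativeSemiring

  pow≡^ : ∀ x n → pow R x n ≡ x ^ n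
  pow≡^ x zero    = ≡.refl
  pow≡^ x (suc n) = ≡.cong (x *_) (pow≡^ x n)

  1^n≈1 : ∀ n → 1# ^ n ≈ 1#
  1^n≈1 zero    = refl
  1^n≈1 (suc n) = trans (*-identityˡ _) (1^n≈1 n)

  module _ {q : ℕ} {{_ : NonZero q}} {x : Carrier} (x^q≈1 : x ^ q ≈ 1#) where

    x^[m*q]≈1 : ∀ m → x ^ (m ℕ.* q) ≈ 1#
    x^[m*q]≈1 m = begin
      x ^ (m ℕ.* q)  ≡⟨ ≡.cong (x ^_) (ℕ.*-comm m q) ⟩
      x ^ (q ℕ.* m)  ≈⟨ ^-assocʳ x q m ⟨
      (x ^ q) ^ m    ≈⟨ ^-congˡ m x^q≈1 ⟩
      1# ^ m         ≈⟨ 1^n≈1 m ⟩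
      1#             ∎

    x^[k%q]≈x^k : ∀ k → x ^ (k % q) ≈ x ^ k
    x^[k%q]≈x^k k = begin
      x ^ (k % q)                      ≈⟨ *-identityʳ _ ⟨
      x ^ (k % q) * 1#                 ≈⟨ *-congˡ (x^[m*q]≈1 (k / q)) ⟨
      x ^ (k % q) * x ^ (k / q ℕ.* q)  ≈⟨ ^-homo-* x (k % q) _ ⟨
      x ^ (k % q ℕ.+ k / q ℕ.* q)      ≡⟨ ≡.cong (x ^_) (m≡m%n+[m/n]*n k q) ⟨
      x ^ k                            ∎

  sumFin≡sum : ∀ n (g : Fin n → Carrier) → sumFin R n g ≡ sum g
  sumFin≡sum n g = ≡.trans (≡.cong (foldr _+_ 0#) (map-tabulate (λ i → i) g)) (foldr-tabulate n g)
    where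
    foldr-tabulate : ∀ n (g : Fin n → Carrier) → foldr _+_ 0# (tabulate g) ≡ sum g
    foldr-tabulate zero    g = ≡.refl
    foldr-tabulate (suc n) g = ≡.cong (g Fin.zero +_) (foldr-tabulate n (λ i → g (Fin.suc i)))

  sumFin-cong : ∀ n {g h : Fin n → Carrier} → (∀ j → g j ≈ h j) → sumFin R n g ≈ sumFin R n h
  sumFin-cong n {g} {h} g≈h = begin
    sumFin R n g  ≡⟨ sumFin≡sum n g ⟩
    sum g         ≈⟨ sum-cong-≋ {n} g≈h ⟩
    sum h         ≡⟨ sumFin≡sum n h ⟨
    sumFin R n h  ∎

  module _ (q : ℕ) where

    sumVec-cong : ∀ m {g h : Vector (Fin q) m → Carrier} → (∀ x → g x ≈ h x) →
                  sumVec R q m g ≈ sumVec R q m h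
    sumVec-cong zero    g≈h = g≈h _
    sumVec-cong (suc m) g≈h = sumFin-cong q (λ j → sumVec-cong m (λ x → g≈h (j ∷ x)))

    sumVec-*ˡ : ∀ m y (g : Vector (Fin q) m → Carrier) →
                sumVec R q m (λ x → y * g x) ≈ y * sumVec R q m g
    sumVec-*ˡ zero    y g = refl
    sumVec-*ˡ (suc m) y g = begin
      sumFin R q (λ j → sumVec R q m (λ x → y * g (j ∷ x)))  ≈⟨ sumFin-cong q (λ j → sumVec-*ˡ m y (λ x → g (j ∷ x))) ⟩
      sumFin R q (λ j → y * G j)                             ≡⟨ sumFin≡sum q _ ⟩
      sum (λ j → y * G j)                                    ≈⟨ *-distribˡ-sum {q} y G ⟨
      y * sum G                                              ≡⟨ ≡.cong (y *_) (sumFin≡sum q G) ⟨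
      y * sumFin R q G                                       ∎
      where
      G : Fin q → Carrier
      G j = sumVec R q m (λ x → g (j ∷ x))

    sumVec-separable : ∀ m {g : Vector (Fin q) (suc m) → Carrier}
                       (φ : Fin q → Carrier) (ψ : Vector (Fin q) m → Carrier) →
                       (∀ j x → g (j ∷ x) ≈ φ j * ψ x) →
                       sumVec R q (suc m) g ≈ sum φ * sumVec R q m ψ
    sumVec-separable m {g} φ ψ g≈φψ = begin
      sumFin R q (λ j → sumVec R q m (λ x → g (j ∷ x)))  ≈⟨ sumFin-cong q (λ j → sumVec-cong m (g≈φψ j)) ⟩
      sumFin R q (λ j → sumVec R q m (λ x → φ j * ψ x))  ≈⟨ sumFin-cong q (λ j → sumVec-*ˡ m (φ j) ψ) ⟩
      sumFin R q (λ j → φ j * sumVec R q m ψ)            ≡⟨ sumFin≡sum q _ ⟩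
      sum (λ j → φ j * sumVec R q m ψ)                   ≈⟨ *-distribʳ-sum {q} (sumVec R q m ψ) φ ⟨
      sum φ * sumVec R q m ψ                             ∎

  geometricSum : ℕ → Carrier → Carrier
  geometricSum n z = ∑[ j < n ] (z ^ toℕ j)

  geometricSum-cong : ∀ n {z w} → z ≈ w → geometricSum n z ≈ geometricSum n w
  geometricSum-cong n z≈w = sum-cong-≋ {n} (λ j → ^-congˡ (toℕ j) z≈w)

  geometricSum*[1-z]+zⁿ≈1 : ∀ n z → geometricSum n z * (1# - z) + z ^ n ≈ 1#
  geometricSum*[1-z]+zⁿ≈1 zero    z = trans (+-congʳ (zeroˡ _)) (+-identityˡ 1#)
  geometricSum*[1-z]+zⁿ≈1 (suc n) z = begin
    (1# + ∑[ j < n ] (z * z ^ toℕ j)) * (1# - z) + z * z ^ n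
      ≈⟨ +-congʳ (*-congʳ (+-congˡ (*-distribˡ-sum {n} z (λ j → z ^ toℕ j)))) ⟨
    (1# + z * G) * (1# - z) + z * z ^ n
      ≈⟨ solve 4 (λ z G d p → (con 1 :+ z :* G) :* d :+ z :* p := d :+ z :* (G :* d :+ p)) refl z G (1# - z) (z ^ n) ⟩
    (1# - z) + z * (G * (1# - z) + z ^ n)
      ≈⟨ +-congˡ (trans (*-congˡ (geometricSum*[1-z]+zⁿ≈1 n z)) (*-identityʳ z)) ⟩
    (1# - z) + z
      ≈⟨ //-rightDividesˡ z 1# ⟩
    1# ∎
    where G = geometricSum n z

  geometricSum*[1-z]≈2 : ∀ n {z} → z ^ n + 1# ≈ 0# → geometricSum n z * (1# - z) ≈ 1# + 1#
  geometricSum*[1-z]≈2 n {z} zⁿ+1≈0 = begin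
    G * (1# - z)                    ≈⟨ +-identityʳ _ ⟨
    G * (1# - z) + 0#               ≈⟨ +-congˡ zⁿ+1≈0 ⟨
    G * (1# - z) + (z ^ n + 1#)     ≈⟨ +-assoc _ _ _ ⟨
    G * (1# - z) + z ^ n + 1#       ≈⟨ +-congʳ (geometricSum*[1-z]+zⁿ≈1 n z) ⟩
    1# + 1#                         ∎
    where G = geometricSum n z

  -- (1 - a)(1 - b) + a + b = 1 + ab, with 1 - a and 1 - b known only through
  -- their sums with a and b (as happens for conj (1 - v)).
  d+a≈1∧e+b≈1⇒de+[a+b]≈1+ab : ∀ {a b d e} → d + a ≈ 1# → e + b ≈ 1# →
                              d * e + (a + b) ≈ 1# + a * b
  d+a≈1∧e+b≈1⇒de+[a+b]≈1+ab {a} {b} {d} {e} d+a≈1 e+b≈1 = begin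
    d * e + (a + b)                          ≈⟨ +-congˡ (+-cong (times-one a e+b≈1) (times-one b d+a≈1)) ⟩
    d * e + (a * (e + b) + b * (d + a))      ≈⟨ solve 4 (λ a b d e → d :* e :+ (a :* (e :+ b) :+ b :* (d :+ a))
                                                                  := (d :+ a) :* (e :+ b) :+ a :* b) refl a b d e ⟩
    (d + a) * (e + b) + a * b                ≈⟨ +-congʳ (trans (*-cong d+a≈1 e+b≈1) (*-identityˡ 1#)) ⟩
    1# + a * b                               ∎
    where
    times-one : ∀ x {y} → y ≈ 1# → x ≈ x * y
    times-one x y≈1 = trans (sym (*-identityʳ x)) (*-congˡ (sym y≈1))

  module _ (inverse : ∀ x → ¬ x ≈ 0# → ∃ λ y → x * y ≈ 1#) where

    *-cancelˡ-≉0 : ∀ {x y z} → ¬ x ≈ 0# → x * y ≈ x * z → y ≈ z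
    *-cancelˡ-≉0 {x} {y} {z} x≉0 xy≈xz with inverse x x≉0
    ... | x⁻¹ , xx⁻¹≈1 = begin
      y              ≈⟨ undo y ⟨
      x⁻¹ * (x * y)  ≈⟨ *-congˡ xy≈xz ⟩
      x⁻¹ * (x * z)  ≈⟨ undo z ⟩
      z              ∎
      where
      undo : ∀ w → x⁻¹ * (x * w) ≈ w
      undo w = begin
        x⁻¹ * (x * w)  ≈⟨ solve 3 (λ x x⁻¹ w → x⁻¹ :* (x :* w) := (x :* x⁻¹) :* w) refl x x⁻¹ w ⟩
        (x * x⁻¹) * w  ≈⟨ *-congʳ xx⁻¹≈1 ⟩
        1# * w         ≈⟨ *-identityˡ w ⟩
        w              ∎

    xy≈xz∧y≉z⇒x≈0 : ∀ {x y z} → x * y ≈ x * z → ¬ y ≈ z → x ≈ 0#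
    xy≈xz∧y≉z⇒x≈0 {x} {y} {z} xy≈xz y≉z = *-cancelˡ-≉0 y-z≉0 (begin
      (y - z) * x      ≈⟨ [y-z]x≈yx-zx x y z ⟩
      y * x - z * x    ≈⟨ x≈y⇒x∙y⁻¹≈ε (trans (*-comm y x) (trans xy≈xz (*-comm x z))) ⟩
      0#               ≈⟨ zeroʳ (y - z) ⟨
      (y - z) * 0#     ∎)
      where
      y-z≉0 : ¬ y - z ≈ 0#
      y-z≉0 y-z≈0 = y≉z (x∙y⁻¹≈ε⇒x≈y y z y-z≈0)

    y²≈1∧y≉1⇒y+1≈0 : ∀ {y} → y * y ≈ 1# → ¬ y ≈ 1# → y + 1# ≈ 0#
    y²≈1∧y≉1⇒y+1≈0 {y} y²≈1 = xy≈xz∧y≉z⇒x≈0 (begin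
      (y + 1#) * y     ≈⟨ distribʳ y y 1# ⟩
      y * y + 1# * y   ≈⟨ +-cong y²≈1 (*-identityˡ y) ⟩
      1# + y           ≈⟨ +-comm 1# y ⟩
      y + 1#           ≈⟨ *-identityʳ _ ⟨
      (y + 1#) * 1#    ∎)

    Z+x≈xZ+1∧x≉1⇒Z≈1 : ∀ {x Z} → Z + x ≈ x * Z + 1# → ¬ x ≈ 1# → Z ≈ 1#
    Z+x≈xZ+1∧x≉1⇒Z≈1 {x} {Z} Z+x≈xZ+1 x≉1 = *-cancelˡ-≉0 1-x≉0 (∙-cancelʳ (x * Z + x) _ _ (begin
      (1# - x) * Z + (x * Z + x)     ≈⟨ solve 3 (λ d x Z → d :* Z :+ (x :* Z :+ x) := (d :+ x) :* Z :+ x) refl (1# - x) x Z ⟩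
      ((1# - x) + x) * Z + x         ≈⟨ +-congʳ (trans (*-congʳ 1-x+x≈1) (*-identityˡ Z)) ⟩
      Z + x                          ≈⟨ Z+x≈xZ+1 ⟩
      x * Z + 1#                     ≈⟨ +-congˡ 1-x+x≈1 ⟨
      x * Z + ((1# - x) + x)         ≈⟨ solve 3 (λ d x Z → x :* Z :+ (d :+ x) := d :* con 1 :+ (x :* Z :+ x)) refl (1# - x) x Z ⟩
      (1# - x) * 1# + (x * Z + x)    ∎))
      where
      1-x+x≈1 : (1# - x) + x ≈ 1#
      1-x+x≈1 = //-rightDividesˡ x 1#
      1-x≉0 : ¬ 1# - x ≈ 0#
      1-x≉0 1-x≈0 = x≉1 (sym (x∙y⁻¹≈ε⇒x≈y 1# x 1-x≈0))

  module _ {q : ℕ} (S : Setting R q) where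
    open Setting S

    ‖_‖² : Carrier → Carrier
    ‖ z ‖² = z * conj z

    ‖‖²-cong : ∀ {x y} → x ≈ y → ‖ x ‖² ≈ ‖ y ‖²
    ‖‖²-cong x≈y = *-cong x≈y (conj-cong x≈y)

    ‖xy‖²≈‖x‖²‖y‖² : ∀ x y → ‖ x * y ‖² ≈ ‖ x ‖² * ‖ y ‖²
    ‖xy‖²≈‖x‖²‖y‖² x y = trans (*-congˡ (conj-* x y))
      (solve 4 (λ x y x̄ ȳ → (x :* y) :* (x̄ :* ȳ) := (x :* x̄) :* (y :* ȳ)) refl x y (conj x) (conj y))

    conj-^ : ∀ x n → conj (x ^ n) ≈ conj x ^ n
    conj-^ x zero    = conj-1
    conj-^ x (suc n) = trans (conj-* x (x ^ n)) (*-congˡ (conj-^ x n))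

    unimodular-* : ∀ {x y} → Unimodular R S x → Unimodular R S y → Unimodular R S (x * y)
    unimodular-* {x} {y} ‖x‖²≈1 ‖y‖²≈1 =
      trans (‖xy‖²≈‖x‖²‖y‖² x y) (trans (*-cong ‖x‖²≈1 ‖y‖²≈1) (*-identityˡ 1#))

    unimodular-^ : ∀ {x} → Unimodular R S x → ∀ n → Unimodular R S (x ^ n)
    unimodular-^ {x} ‖x‖²≈1 n = begin
      x ^ n * conj (x ^ n)   ≈⟨ *-congˡ (conj-^ x n) ⟩
      x ^ n * conj x ^ n     ≈⟨ ^-distrib-* x (conj x) n ⟨
      ‖ x ‖² ^ n             ≈⟨ ^-congˡ n ‖x‖²≈1 ⟩
      1# ^ n                 ≈⟨ 1^n≈1 n ⟩
      1#                     ∎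

    ‖1-v‖²+[v+v̄]≈1+‖v‖² : ∀ v → ‖ 1# - v ‖² + (v + conj v) ≈ 1# + ‖ v ‖²
    ‖1-v‖²+[v+v̄]≈1+‖v‖² v = d+a≈1∧e+b≈1⇒de+[a+b]≈1+ab 1-v+v≈1 (begin
      conj (1# - v) + conj v  ≈⟨ conj-+ (1# - v) v ⟨
      conj ((1# - v) + v)     ≈⟨ conj-cong 1-v+v≈1 ⟩
      conj 1#                 ≈⟨ conj-1 ⟩
      1#                      ∎)
      where
      1-v+v≈1 : (1# - v) + v ≈ 1#
      1-v+v≈1 = //-rightDividesˡ v 1#

    ‖1-w‖²≈‖1-xw‖²⇒xw²≈1 : ∀ {w x} → Unimodular R S w → Unimodular R S x → ¬ x ≈ 1# →
                            ‖ 1# - w ‖² ≈ ‖ 1# - x * w ‖² → x * (w * w) ≈ 1#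
    ‖1-w‖²≈‖1-xw‖²⇒xw²≈1 {w} {x} ‖w‖²≈1 ‖x‖²≈1 x≉1 ‖1-w‖²≈‖1-xw‖² =
      Z+x≈xZ+1∧x≉1⇒Z≈1 field-inv (begin
        x * (w * w) + x                         ≈⟨ +-congˡ (trans (*-congˡ ‖w‖²≈1) (*-identityʳ x)) ⟨
        x * (w * w) + x * ‖ w ‖²                ≈⟨ solve 3 (λ x w w̄ → x :* (w :* w) :+ x :* (w :* w̄) := (x :* w) :* (w :+ w̄)) refl x w (conj w) ⟩
        (x * w) * (w + conj w)                  ≈⟨ *-congˡ re-w≈re-xw ⟩
        (x * w) * (x * w + conj (x * w))        ≈⟨ solve 3 (λ x w y → (x :* w) :* (x :* w :+ y) := x :* (x :* (w :* w)) :+ (x :* w) :* y) refl x w (conj (x * w)) ⟩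
        x * (x * (w * w)) + ‖ x * w ‖²          ≈⟨ +-congˡ (unimodular-* ‖x‖²≈1 ‖w‖²≈1) ⟩
        x * (x * (w * w)) + 1#                  ∎) x≉1
      where
      re-w≈re-xw : w + conj w ≈ x * w + conj (x * w)
      re-w≈re-xw = ∙-cancelˡ ‖ 1# - x * w ‖² _ _ (begin
        ‖ 1# - x * w ‖² + (w + conj w)                 ≈⟨ +-congʳ ‖1-w‖²≈‖1-xw‖² ⟨
        ‖ 1# - w ‖² + (w + conj w)                     ≈⟨ ‖1-v‖²+[v+v̄]≈1+‖v‖² w ⟩
        1# + ‖ w ‖²                                    ≈⟨ +-congˡ (trans ‖w‖²≈1 (sym (unimodular-* ‖x‖²≈1 ‖w‖²≈1))) ⟩
        1# + ‖ x * w ‖²                                ≈⟨ ‖1-v‖²+[v+v̄]≈1+‖v‖² (x * w) ⟨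
        ‖ 1# - x * w ‖² + (x * w + conj (x * w))       ∎)

    ξ^q≈1 : ξ ^ q ≈ 1#
    ξ^q≈1 = trans (reflexive (≡.sym (pow≡^ ξ q))) ξ-root

    ξ^k≉1 : ∀ {k} → 0 < k → k < q → ¬ ξ ^ k ≈ 1#
    ξ^k≉1 {k} 0<k k<q ξ^k≈1 = ξ-prim k 0<k k<q (trans (reflexive (pow≡^ ξ k)) ξ^k≈1)

    ‖ξ‖²≈1 : Unimodular R S ξ
    ‖ξ‖²≈1 = trans (*-comm ξ (conj ξ)) ξ-conj

    ‖ω‖²≈1 : Unimodular R S ω
    ‖ω‖²≈1 = trans (*-comm ω (conj ω)) ω-conj

    ω^q+1≈0 : {{NonZero q}} → ω ^ q + 1# ≈ 0#
    ω^q+1≈0 = y²≈1∧y≉1⇒y+1≈0 field-inv ω^q*ω^q≈1 ω^q≉1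
      where
      0<q : 0 < q
      0<q = ℕ.>-nonZero⁻¹ q
      ω^q*ω^q≈1 : ω ^ q * ω ^ q ≈ 1#
      ω^q*ω^q≈1 = begin
        ω ^ q * ω ^ q          ≈⟨ ^-homo-* ω q q ⟨
        ω ^ (q ℕ.+ q)          ≡⟨ ≡.cong (λ k → ω ^ (q ℕ.+ k)) (ℕ.+-identityʳ q) ⟨
        ω ^ (2 ℕ.* q)          ≡⟨ pow≡^ ω (2 ℕ.* q) ⟨
        pow R ω (2 ℕ.* q)      ≈⟨ ω-root ⟩
        1#                     ∎
      ω^q≉1 : ¬ ω ^ q ≈ 1#
      ω^q≉1 ω^q≈1 = ω-prim q 0<q (ℕ.m<m+n q (ℕ.<-≤-trans 0<q (ℕ.m≤m+n q 0))) (trans (reflexive (pow≡^ ω q)) ω^q≈1)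

    ‖1-ξᶜω‖²-nonconstant : 2 < q → ∀ K → ¬ (∀ c → ‖ 1# - ξ ^ c * ω ‖² ≈ K)
    ‖1-ξᶜω‖²-nonconstant 2<q K ‖1-ξᶜω‖²≈K = ξ^k≉1 (s≤s z≤n) 1<q (begin
      ξ * 1#                       ≈⟨ *-congˡ ξω²≈1 ⟨
      ξ * (ξ ^ 1 * (ω * ω))        ≈⟨ *-assoc ξ (ξ ^ 1) (ω * ω) ⟨
      ξ ^ 2 * (ω * ω)              ≈⟨ ξ²ω²≈1 ⟩
      1#                           ∎)
      where
      1<q : 1 < q
      1<q = ℕ.<-trans (s≤s (s≤s z≤n)) 2<q
      same : ∀ c → ‖ 1# - ω ‖² ≈ ‖ 1# - ξ ^ c * ω ‖²
      same c = trans (‖‖²-cong (+-congˡ (-‿cong (sym (*-identityˡ ω))))) (trans (‖1-ξᶜω‖²≈K 0) (sym (‖1-ξᶜω‖²≈K c)))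
      ξω²≈1 : ξ ^ 1 * (ω * ω) ≈ 1#
      ξω²≈1 = ‖1-w‖²≈‖1-xw‖²⇒xw²≈1 ‖ω‖²≈1 (unimodular-^ ‖ξ‖²≈1 1) (ξ^k≉1 (s≤s z≤n) 1<q) (same 1)
      ξ²ω²≈1 : ξ ^ 2 * (ω * ω) ≈ 1#
      ξ²ω²≈1 = ‖1-w‖²≈‖1-xw‖²⇒xw²≈1 ‖ω‖²≈1 (unimodular-^ ‖ξ‖²≈1 2) (ξ^k≉1 (s≤s z≤n) 2<q) (same 2)

    summand : ∀ {n} → (Vector (Fin q) n → ℕ) → Vector (Fin q) n → Vector (Fin q) n → Carrier
    summand f u x = pow R ξ (f x) * pow R ξ (dotℕ R S x u) * pow R ω (sumℕ R S x)

    summand≡ : ∀ {n} f (u x : Vector (Fin q) n) →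
               summand f u x ≡ ξ ^ f x * ξ ^ dotℕ R S x u * ω ^ sumℕ R S x
    summand≡ f u x = ≡.cong₂ _*_ (≡.cong₂ _*_ (pow≡^ ξ (f x)) (pow≡^ ξ (dotℕ R S x u))) (pow≡^ ω (sumℕ R S x))

    module _ {{_ : NonZero q}} where

      summand-∷ : ∀ {m} (a : Vector (Fin q) (suc m)) b u₀ u j x →
                  summand (affineRep R S a b) (u₀ ∷ u) (j ∷ x) ≈
                  (ξ ^ (toℕ (a Fin.zero) ℕ.+ toℕ u₀) * ω) ^ toℕ j * summand (affineRep R S (tail a) b) u x
      summand-∷ a b u₀ u j x = begin
        summand (affineRep R S a b) (u₀ ∷ u) (j ∷ x)
          ≡⟨ summand≡ (affineRep R S a b) (u₀ ∷ u) (j ∷ x) ⟩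
        ξ ^ ((a₀ ℕ.* k ℕ.+ r) % q) * ξ ^ (k ℕ.* v ℕ.+ d) * ω ^ (k ℕ.+ s)
          ≈⟨ *-cong (*-cong (trans (x^[k%q]≈x^k ξ^q≈1 _) (^-homo-* ξ (a₀ ℕ.* k) r)) (^-homo-* ξ (k ℕ.* v) d)) (^-homo-* ω k s) ⟩
        (ξ ^ (a₀ ℕ.* k) * ξ ^ r) * (ξ ^ (k ℕ.* v) * ξ ^ d) * (ω ^ k * ω ^ s)
          ≈⟨ solve 6 (λ A r B d W s → (A :* r) :* (B :* d) :* (W :* s) := (A :* B :* W) :* (r :* d :* s))
                     refl (ξ ^ (a₀ ℕ.* k)) (ξ ^ r) (ξ ^ (k ℕ.* v)) (ξ ^ d) (ω ^ k) (ω ^ s) ⟩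
        (ξ ^ (a₀ ℕ.* k) * ξ ^ (k ℕ.* v) * ω ^ k) * (ξ ^ r * ξ ^ d * ω ^ s)
          ≈⟨ *-cong (*-congʳ ξ^[a₀k]ξ^[kv]≈[ξ^[a₀+v]]^k) (reflexive (≡.sym (summand≡ (affineRep R S (tail a) b) u x))) ⟩
        (ξ ^ (a₀ ℕ.+ v)) ^ k * ω ^ k * summand (affineRep R S (tail a) b) u x
          ≈⟨ *-congʳ (^-distrib-* (ξ ^ (a₀ ℕ.+ v)) ω k) ⟨
        (ξ ^ (a₀ ℕ.+ v) * ω) ^ k * summand (affineRep R S (tail a) b) u x
          ∎
        where
        a₀ = toℕ (a Fin.zero)
        k = toℕ j
        v = toℕ u₀
        r = affineRep R S (tail a) b x
        d = dotℕ R S x u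
        s = sumℕ R S x
        ξ^[a₀k]ξ^[kv]≈[ξ^[a₀+v]]^k : ξ ^ (a₀ ℕ.* k) * ξ ^ (k ℕ.* v) ≈ (ξ ^ (a₀ ℕ.+ v)) ^ k
        ξ^[a₀k]ξ^[kv]≈[ξ^[a₀+v]]^k = begin
          ξ ^ (a₀ ℕ.* k) * ξ ^ (k ℕ.* v)   ≈⟨ ^-homo-* ξ (a₀ ℕ.* k) (k ℕ.* v) ⟨
          ξ ^ (a₀ ℕ.* k ℕ.+ k ℕ.* v)       ≡⟨ ≡.cong (ξ ^_) (≡.trans (≡.cong (a₀ ℕ.* k ℕ.+_) (ℕ.*-comm k v)) (≡.sym (ℕ.*-distribʳ-+ k a₀ v))) ⟩
          ξ ^ ((a₀ ℕ.+ v) ℕ.* k)           ≈⟨ ^-assocʳ ξ (a₀ ℕ.+ v) k ⟨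
          (ξ ^ (a₀ ℕ.+ v)) ^ k             ∎

      negaHadamard-∷ : ∀ {m} (a : Vector (Fin q) (suc m)) b u₀ u →
                       negaHadamard R S (suc m) (affineRep R S a b) (u₀ ∷ u) ≈
                       geometricSum q (ξ ^ (toℕ (a Fin.zero) ℕ.+ toℕ u₀) * ω) *
                       (t * negaHadamard R S m (affineRep R S (tail a) b) u)
      negaHadamard-∷ {m} a b u₀ u = begin
        t * pow R t m * sumVec R q (suc m) (summand (affineRep R S a b) (u₀ ∷ u))
          ≈⟨ *-congˡ (sumVec-separable q m {summand (affineRep R S a b) (u₀ ∷ u)} (λ j → ζ ^ toℕ j) W (summand-∷ a b u₀ u)) ⟩
        t * pow R t m * (geometricSum q ζ * sumVec R q m W)
          ≈⟨ solve 4 (λ t p G W → t :* p :* (G :* W) := G :* (t :* (p :* W))) refl t (pow R t m) (geometricSum q ζ) (sumVec R q m W) ⟩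
        geometricSum q ζ * (t * (pow R t m * sumVec R q m W))
          ∎
        where
        ζ = ξ ^ (toℕ (a Fin.zero) ℕ.+ toℕ u₀) * ω
        W = summand (affineRep R S (tail a) b) u

      shift : Fin q → ℕ → Fin q
      shift a c = fromℕ< (m%n<n (q ∸ toℕ a ℕ.+ c) q)

      ξ^[a+shift]≈ξᶜ : ∀ a c → ξ ^ (toℕ a ℕ.+ toℕ (shift a c)) ≈ ξ ^ c
      ξ^[a+shift]≈ξᶜ a c = begin
        ξ ^ (toℕ a ℕ.+ toℕ (shift a c))   ≡⟨ ≡.cong (λ k → ξ ^ (toℕ a ℕ.+ k)) (toℕ-fromℕ< (m%n<n r q)) ⟩
        ξ ^ (toℕ a ℕ.+ r % q)             ≈⟨ ^-homo-* ξ (toℕ a) (r % q) ⟩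
        ξ ^ toℕ a * ξ ^ (r % q)           ≈⟨ *-congˡ (x^[k%q]≈x^k ξ^q≈1 r) ⟩
        ξ ^ toℕ a * ξ ^ r                 ≈⟨ ^-homo-* ξ (toℕ a) r ⟨
        ξ ^ (toℕ a ℕ.+ r)                 ≡⟨ ≡.cong (ξ ^_) a+r≡q+c ⟩
        ξ ^ (q ℕ.+ c)                     ≈⟨ ^-homo-* ξ q c ⟩
        ξ ^ q * ξ ^ c                     ≈⟨ trans (*-congʳ ξ^q≈1) (*-identityˡ _) ⟩
        ξ ^ c                             ∎
        where
        r = q ∸ toℕ a ℕ.+ c
        a+r≡q+c : toℕ a ℕ.+ r ≡ q ℕ.+ c
        a+r≡q+c = ≡.trans (≡.sym (ℕ.+-assoc (toℕ a) (q ∸ toℕ a) c))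
                          (≡.cong (ℕ._+ c) (ℕ.m+[n∸m]≡n (ℕ.<⇒≤ (toℕ<n a))))

      [ξᶜω]^q+1≈0 : ∀ c → (ξ ^ c * ω) ^ q + 1# ≈ 0#
      [ξᶜω]^q+1≈0 c = begin
        (ξ ^ c * ω) ^ q + 1#       ≈⟨ +-congʳ (^-distrib-* (ξ ^ c) ω q) ⟩
        (ξ ^ c) ^ q * ω ^ q + 1#   ≈⟨ +-congʳ (*-congʳ (trans (^-assocʳ ξ c q) (x^[m*q]≈1 ξ^q≈1 c))) ⟩
        1# * ω ^ q + 1#            ≈⟨ +-congʳ (*-identityˡ _) ⟩
        ω ^ q + 1#                 ≈⟨ ω^q+1≈0 ⟩
        0#                         ∎

      module _ {m} (a : Vector (Fin q) (suc m)) (b : Fin q)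
               (unimodular : ∀ v → Unimodular R S (negaHadamard R S (suc m) (affineRep R S a b) v))
               (u : Vector (Fin q) m) where

        M : Carrier
        M = t * negaHadamard R S m (affineRep R S (tail a) b) u

        ‖1-ξᶜω‖²≈‖2‖²‖M‖² : ∀ c → ‖ 1# - ξ ^ c * ω ‖² ≈ ‖ 1# + 1# ‖² * ‖ M ‖²
        ‖1-ξᶜω‖²≈‖2‖²‖M‖² c = begin
          ‖ 1# - z ‖²                          ≈⟨ *-identityʳ _ ⟨
          ‖ 1# - z ‖² * 1#                     ≈⟨ *-congˡ ‖G‖²‖M‖²≈1 ⟨
          ‖ 1# - z ‖² * (‖ G ‖² * ‖ M ‖²)      ≈⟨ solve 3 (λ d G M → d :* (G :* M) := G :* d :* M) refl ‖ 1# - z ‖² ‖ G ‖² ‖ M ‖² ⟩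
          ‖ G ‖² * ‖ 1# - z ‖² * ‖ M ‖²        ≈⟨ *-congʳ (‖xy‖²≈‖x‖²‖y‖² G (1# - z)) ⟨
          ‖ G * (1# - z) ‖² * ‖ M ‖²           ≈⟨ *-congʳ (‖‖²-cong (geometricSum*[1-z]≈2 q ([ξᶜω]^q+1≈0 c))) ⟩
          ‖ 1# + 1# ‖² * ‖ M ‖²                ∎
          where
          z = ξ ^ c * ω
          G = geometricSum q z
          N≈GM : negaHadamard R S (suc m) (affineRep R S a b) (shift (a Fin.zero) c ∷ u) ≈ G * M
          N≈GM = trans (negaHadamard-∷ a b (shift (a Fin.zero) c) u)
                       (*-congʳ (geometricSum-cong q (*-congʳ (ξ^[a+shift]≈ξᶜ (a Fin.zero) c))))
          ‖G‖²‖M‖²≈1 : ‖ G ‖² * ‖ M ‖² ≈ 1#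
          ‖G‖²‖M‖²≈1 = trans (sym (‖xy‖²≈‖x‖²‖y‖² G M))
                             (trans (‖‖²-cong (sym N≈GM)) (unimodular (shift (a Fin.zero) c ∷ u)))

theorem2 : ∀ {c ℓ} (R : CommutativeRing c ℓ) (q n : ℕ) → 2 < q → 1 ≤ n →
    {{_ : NonZero q}} → (S : Setting R q) →
    (a : Vector (Fin q) n) (b : Fin q) →
    ¬ (∀ (u : Vector (Fin q) n) →
         Unimodular R S (negaHadamard R S n (affineRep R S a b) u))
theorem2 R q zero    2<q ()
theorem2 R q (suc m) 2<q _  S a b unimodular =
  ‖1-ξᶜω‖²-nonconstant R S 2<q _ (‖1-ξᶜω‖²≈‖2‖²‖M‖² R S a b unimodular (λ _ → fromℕ< (ℕ.>-nonZero⁻¹ q)))
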